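{- For every $n\geq 1$, \[ P_n(x,y)=(2n-1)!!\,(x+y)^n \qquad\text{and}\qquad O_n(x,y,t)=\sum_{r=1}^n t^r S_{n,r}\,(x+y)^{n-r}, \] where $(2n-1)!!=1\cdot 3\cdots(2n-1)$, and $P_n$, $O_n$, $S_{n,r}$ are as defined in the context.
   Context: A labeled plane tree with $n$ edges is a rooted tree on $n+1$ vertices, labeled bijectively by $\{1,2,\ldots,n+1\}$, in which the children of every vertex are linearly ordered (left to right). Let $\mathcal{P}_n$ be the set of labeled plane trees with $n$ edges. Let $\mathcal{O}_n\subseteq\mathcal{P}_n$ be the subset of those whose root is labeled $1$. For a vertex $j$ of $T\in\mathcal{P}_n$, let $\beta(j)$ be the smallest label in the subtree rooted at $j$. If a vertex $j$ has children $j_1,j_2,\ldots,j_k$ (in left-to-right order), the edge $(j,j_i)$ is called improper if $\beta(j_i)<\min\{j,\beta(j_{i+1}),\ldots,\beta(j_k)\}$, and proper otherwise. Let $\mathrm{impr}(T)$ and $\mathrm{prop}(T)$ be the numbers of improper and proper edges of $T$, and let $\deg_T(1)$ be the number of children of the vertex $1$. Define \[ P_n(x,y)=\sum_{T\in\mathcal{P}_n}x^{\mathrm{impr}(T)}y^{\mathrm{prop}(T)},\qquad O_n(x,y,t)=\sum_{T\in\mathcal{O}_n}x^{\mathrm{impr}(T)}y^{\mathrm{prop}(T)-\deg_T(1)}t^{\deg_T(1)}. \] An increasing plane tree with $n$ edges is a labeled plane tree with $n$ edges in which labels increase along every path starting at the root (so the root is $1$). For $1\le r\le n$, $S_{n,r}$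 denotes the number of increasing plane trees with $n$ edges in which the root $1$ has exactly $r$ children. -}

module Defs where

open import Data.Nat using (ℕ; zero; suc; _+_; _*_; _∸_; _^_; _<_; _<ᵇ_; _⊓_; _≟_)
open import Data.Bool using (if_then_else_)
open import Data.List using (List; []; _∷_; _++_; map; upTo; length; filter)
open import Data.Nat.ListAction using (sum)
open import Data.List.Membership.Propositional using (_∈_)
open import Data.List.Relation.Unary.Unique.Propositional using (Unique)
open import Data.List.Relation.Binary.Permutation.Propositional using (_↭_)
open import Data.Product using (_×_)
open import Data.Unit using (⊤)
open import Function.Bundles using (_⇔_)
open import Relation.Binary.PropositionalEquality using (_≡_)

-- Plane trees with natural-number labels: a vertex label and the
-- left-to-right ordered list of subtrees rooted at its children.
data PTree : Set where
  node : ℕ → List PTree → PTree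

rootLabel : PTree → ℕ
rootLabel (node j _) = j

rootDeg : PTree → ℕ
rootDeg (node _ cs) = length cs

mutual
  labels : PTree → List ℕ
  labels (node j cs) = j ∷ labelsF cs

  labelsF : List PTree → List ℕ
  labelsF [] = []
  labelsF (c ∷ cs) = labels c ++ labelsF cs

oneTo : ℕ → List ℕ
oneTo m = map suc (upTo m)

-- T is a labeled plane tree with n edges: its n+1 vertices carry
-- the labels 1..n+1 bijectively.
LabeledPlane : ℕ → PTree → Set
LabeledPlane n T = labels T ↭ oneTo (suc n)

mutual
  β : PTree → ℕ
  β (node j cs) = βF j cs

  βF : ℕ → List PTree → ℕ
  βF m [] = m
  βF m (c ∷ cs) = β c ⊓ βF m cs

mutual
  impr : PTree → ℕ
  impr (node j cs) = imprF j cs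

  -- improper edges from a parent labeled j to the children list cs
  -- (edge (j,c) improper iff β(c) < min{j, β of the children to the right}),
  -- plus the improper edges inside the subtrees
  imprF : ℕ → List PTree → ℕ
  imprF j [] = 0
  imprF j (c ∷ cs) = (if β c <ᵇ βF j cs then 1 else 0) + impr c + imprF j cs

mutual
  prop : PTree → ℕ
  prop (node j cs) = propF j cs

  propF : ℕ → List PTree → ℕ
  propF j [] = 0
  propF j (c ∷ cs) = (if β c <ᵇ βF j cs then 0 else 1) + prop c + propF j cs

mutual
  Increasing : PTree → Set
  Increasing (node j cs) = IncreasingF j cs

  IncreasingF : ℕ → List PTree → Set
  IncreasingF j [] = ⊤
  IncreasingF j (c ∷ cs) = (j < rootLabel c) × Increasing c × IncreasingF j cs

IncreasingPlane : ℕ → PTree → Set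
IncreasingPlane n T = LabeledPlane n T × Increasing T

-- L lists every element satisfying P exactly once (so summing over L is
-- summing over the finite set {T | P T})
Enumerates : (PTree → Set) → List PTree → Set
Enumerates P L = Unique L × (∀ T → (T ∈ L) ⇔ P T)

wP : ℕ → ℕ → PTree → ℕ
wP x y T = x ^ impr T * y ^ prop T

wO : ℕ → ℕ → ℕ → PTree → ℕ
wO x y t T = x ^ impr T * y ^ (prop T ∸ rootDeg T) * t ^ rootDeg T

Psum : ℕ → ℕ → List PTree → ℕ
Psum x y L = sum (map (wP x y) L)

Osum : ℕ → ℕ → ℕ → List PTree → ℕ
Osum x y t L = sum (map (wO x y t) L)

Scount : List PTree → ℕ → ℕ
Scount LI r = length (filter (λ T → rootDeg T ≟ r) LI)

oddFact : ℕ → ℕ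
oddFact zero = 1
oddFact (suc n) = (2 * n + 1) * oddFact n

Orhs : ℕ → ℕ → ℕ → ℕ → List PTree → ℕ
Orhs n x y t LI = sum (map (λ r → t ^ r * Scount LI r * (x + y) ^ (n ∸ r)) (oneTo n))

{-# OPTIONS --safe #-}
-- Let m = n + 2 be the largest label of a labeled plane tree with n + 1 edges. Removing m is inverted
-- by exactly one of two insertions at one of the 2n + 1 gaps of a tree with n edges (a vertex with d
-- children has d + 1 gaps): m becomes a new leaf in that gap, or m takes the place of the vertex v,
-- keeps the children of v left of the gap, and adopts v, carrying its remaining children, as its last
-- child. As m exceeds every label no other edge changes status; the new leaf adds a proper edge and
-- the new parent an improper one, so P_{n+1} = (2n+1)(x+y) P_n.
-- For O_n, replace t^deg by an arbitrary weight F(deg). Among the insertions keeping the root 1, the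
-- d + 1 leaves at the root raise its degree and the others contribute x + y. The sum of
-- (x+y)^(n-deg) F(deg) over increasing trees, which only leaf insertions keep increasing, obeys the
-- same recursion; both sums are F(0) for n = 0, so they agree for all n and F.
module Submission where

open import Defs
open import Data.Bool using (true; false; if_then_else_)
open import Data.List
  using (List; []; _∷_; _++_; _∷ʳ_; [_]; map; upTo; length; filter; concatMap; cartesianProduct; initLast; _∷ʳ′_)
import Data.List.Properties as List
open import Data.List.Membership.Propositional using (_∈_; _∉_)
open import Data.List.Membership.Propositional.Properties
open import Data.List.Membership.Propositional.Properties.WithK using (unique∧set⇒bag)
open import Data.List.Relation.Binary.BagAndSetEquality using (∼bag⇒↭)
open import Data.List.Relation.Binary.Disjoint.Propositional using (Disjoint)
open import Data.List.Relation.Binary.Permutation.Propositional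
  using (_↭_; ↭-refl; ↭-reflexive; ↭-sym; ↭-trans; prep; swap)
import Data.List.Relation.Binary.Permutation.Propositional.Properties as Perm
open import Data.List.Relation.Unary.All as All using (All; []; _∷_)
import Data.List.Relation.Unary.All.Properties as All
open import Data.List.Relation.Unary.Any using (here; there)
open import Data.List.Relation.Unary.Unique.Propositional using (Unique; []; _∷_)
import Data.List.Relation.Unary.Unique.Propositional.Properties as Unique
open import Data.Maybe using (Maybe; just; nothing)
import Data.Maybe as Maybe
open import Data.Nat
  using (ℕ; zero; suc; _+_; _*_; _^_; _∸_; _≤_; _<_; _<ᵇ_; _⊓_; _≟_; _<?_; z≤n; s≤s; s≤s⁻¹)
open import Data.Nat.ListAction using (sum)
open import Data.Nat.ListAction.Properties using (sum-++; sum-↭)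
open import Data.Nat.Properties
open import Data.Nat.Solver using (module +-*-Solver)
open import Data.Product using (∃-syntax; _×_; _,_; proj₁; proj₂)
open import Data.Product.Function.NonDependent.Propositional using (_×-⇔_)
open import Data.Sum using (_⊎_; inj₁; inj₂)
open import Data.Unit using (tt)
open import Function.Base using (_∘_; const)
open import Function.Bundles using (_⇔_; Equivalence; mk⇔)
open import Function.Construct.Identity using (⇔-id)
open import Relation.Nullary using (Dec; yes; no; does; ¬_)
open import Relation.Nullary.Decidable using (_×-dec_; does-⇔; dec-true; dec-false; dec-no)
open import Relation.Unary using (Decidable)
open import Relation.Binary.PropositionalEquality hiding ([_])

open +-*-Solver using (solve; _:+_; _:*_; _:=_; con)

sum-const : ∀ {A : Set} c (xs : List A) → sum (map (λ _ → c) xs) ≡ length xs * c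
sum-const c [] = refl
sum-const c (x ∷ xs) = cong (c +_) (sum-const c xs)

sum-*ˡ : ∀ {A : Set} c (f : A → ℕ) xs → sum (map (λ x → c * f x) xs) ≡ c * sum (map f xs)
sum-*ˡ c f [] = sym (*-zeroʳ c)
sum-*ˡ c f (x ∷ xs) = trans (cong (c * f x +_) (sum-*ˡ c f xs)) (sym (*-distribˡ-+ c (f x) _))

sum-map-+ : ∀ {A : Set} (f g : A → ℕ) xs → sum (map (λ x → f x + g x) xs) ≡ sum (map f xs) + sum (map g xs)
sum-map-+ f g [] = refl
sum-map-+ f g (x ∷ xs) rewrite sum-map-+ f g xs =
  solve 4 (λ a b c d → a :+ b :+ (c :+ d) := a :+ c :+ (b :+ d)) refl (f x) (g x) (sum (map f xs)) (sum (map g xs))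

sum-map-∘ : ∀ {A B : Set} (f : B → ℕ) (g : A → B) xs → sum (map f (map g xs)) ≡ sum (map (f ∘ g) xs)
sum-map-∘ f g xs = cong sum (sym (List.map-∘ xs))

sum-map-↭ : ∀ {A : Set} (f : A → ℕ) {xs ys} → xs ↭ ys → sum (map f xs) ≡ sum (map f ys)
sum-map-↭ f xs↭ys = sum-↭ (Perm.map⁺ f xs↭ys)

sum-concatMap : ∀ {A B : Set} (f : B → ℕ) (g : A → List B) xs →
                sum (map f (concatMap g xs)) ≡ sum (map (λ x → sum (map f (g x))) xs)
sum-concatMap f g [] = refl
sum-concatMap f g (x ∷ xs) = begin
    sum (map f (g x ++ concatMap g xs))               ≡⟨ cong sum (List.map-++ f (g x) _) ⟩
    sum (map f (g x) ++ map f (concatMap g xs))       ≡⟨ sum-++ (map f (g x)) _ ⟩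
    sum (map f (g x)) + sum (map f (concatMap g xs))  ≡⟨ cong (sum (map f (g x)) +_) (sum-concatMap f g xs) ⟩
    sum (map f (g x)) + sum (map (λ x → sum (map f (g x))) xs) ∎
  where open ≡-Reasoning

sum-cartesianProduct : ∀ {A B : Set} (f : A × B → ℕ) xs ys →
                       sum (map f (cartesianProduct xs ys)) ≡ sum (map (λ x → sum (map (λ y → f (x , y)) ys)) xs)
sum-cartesianProduct f [] ys = refl
sum-cartesianProduct f (x ∷ xs) ys = begin
    sum (map f (map (x ,_) ys ++ cartesianProduct xs ys))
      ≡⟨ cong sum (List.map-++ f (map (x ,_) ys) _) ⟩
    sum (map f (map (x ,_) ys) ++ map f (cartesianProduct xs ys))
      ≡⟨ sum-++ (map f (map (x ,_) ys)) _ ⟩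
    sum (map f (map (x ,_) ys)) + sum (map f (cartesianProduct xs ys))
      ≡⟨ cong₂ _+_ (sum-map-∘ f (x ,_) ys) (sum-cartesianProduct f xs ys) ⟩
    sum (map (λ y → f (x , y)) ys) + sum (map (λ x → sum (map (λ y → f (x , y)) ys)) xs) ∎
  where open ≡-Reasoning

sum-filter : ∀ {A : Set} {P : A → Set} (P? : Decidable P) (f : A → ℕ) xs →
             sum (map f (filter P? xs)) ≡ sum (map (λ x → if does (P? x) then f x else 0) xs)
sum-filter P? f [] = refl
sum-filter P? f (x ∷ xs) with does (P? x)
... | true = cong (f x +_) (sum-filter P? f xs)
... | false = sum-filter P? f xs

length-filter-∷ : ∀ {A : Set} {P : A → Set} (P? : Decidable P) x xs →
                  length (filter P? (x ∷ xs)) ≡ (if does (P? x) then 1 else 0) + length (filter P? xs)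
length-filter-∷ P? x xs with does (P? x)
... | true = refl
... | false = refl

length-map-++ : ∀ {A B C : Set} (f : A → C) (g : B → C) xs ys →
                length (map f xs ++ map g ys) ≡ length xs + length ys
length-map-++ f g xs ys = trans (List.length-++ (map f xs)) (cong₂ _+_ (List.length-map f xs) (List.length-map g ys))

module _ (g : ℕ → ℕ) where

  sum-indicator-∉ : ∀ {k rs} → k ∉ rs → sum (map (λ r → (if does (k ≟ r) then 1 else 0) * g r) rs) ≡ 0
  sum-indicator-∉ {k} {[]} _ = refl
  sum-indicator-∉ {k} {r ∷ rs} k∉ rewrite dec-false (k ≟ r) (k∉ ∘ here) = sum-indicator-∉ (k∉ ∘ there)

  sum-indicator : ∀ {k rs} → Unique rs → k ∈ rs →
                  sum (map (λ r → (if does (k ≟ r) then 1 else 0) * g r) rs) ≡ g k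
  sum-indicator {k} {r ∷ rs} (r∉rs ∷ _) (here refl)
    rewrite dec-true (k ≟ k) refl | sum-indicator-∉ (λ k∈rs → All.lookup r∉rs k∈rs refl) =
      trans (+-identityʳ _) (*-identityˡ (g k))
  sum-indicator {k} {r ∷ rs} (r∉rs ∷ u) (there k∈rs)
    rewrite dec-false (k ≟ r) (λ { refl → All.lookup r∉rs k∈rs refl }) = sum-indicator u k∈rs

  sum-fibres : ∀ {A : Set} (deg : A → ℕ) {rs} → Unique rs → ∀ xs → All (λ a → deg a ∈ rs) xs →
               sum (map (λ r → length (filter (λ a → deg a ≟ r) xs) * g r) rs) ≡ sum (map (g ∘ deg) xs)
  sum-fibres deg {rs} u [] [] = trans (sum-const 0 rs) (*-zeroʳ (length rs))
  sum-fibres deg {rs} u (x ∷ xs) (dx∈ ∷ ds) = begin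
      sum (map (λ r → length (filter (λ a → deg a ≟ r) (x ∷ xs)) * g r) rs)
        ≡⟨ cong sum (List.map-cong split-fibre rs) ⟩
      sum (map (λ r → indicator r * g r + length (filter (λ a → deg a ≟ r) xs) * g r) rs)
        ≡⟨ sum-map-+ _ _ rs ⟩
      sum (map (λ r → indicator r * g r) rs) + sum (map (λ r → length (filter (λ a → deg a ≟ r) xs) * g r) rs)
        ≡⟨ cong₂ _+_ (sum-indicator u dx∈) (sum-fibres deg u xs ds) ⟩
      g (deg x) + sum (map (g ∘ deg) xs) ∎
    where
      open ≡-Reasoning
      indicator : ℕ → ℕ
      indicator r = if does (deg x ≟ r) then 1 else 0
      split-fibre : ∀ r → length (filter (λ a → deg a ≟ r) (x ∷ xs)) * g r
                          ≡ indicator r * g r + length (filter (λ a → deg a ≟ r) xs) * g r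
      split-fibre r = trans (cong (_* g r) (length-filter-∷ (λ a → deg a ≟ r) x xs))
                            (*-distribʳ-+ (g r) (indicator r) (length (filter (λ a → deg a ≟ r) xs)))

unique-⇔⇒↭ : ∀ {A : Set} {xs ys : List A} → Unique xs → Unique ys →
             (∀ {z} → z ∈ xs ⇔ z ∈ ys) → xs ↭ ys
unique-⇔⇒↭ u v eq = ∼bag⇒↭ (unique∧set⇒bag u v eq)

unique-map-retraction : ∀ {A B D : Set} {f : A → B} (g : B → D) {h : A → D} → (∀ {a b} → h a ≡ h b → a ≡ b) →
                        ∀ {xs} → All (λ a → g (f a) ≡ h a) xs → Unique xs → Unique (map f xs)
unique-map-retraction {f = f} g {h} h-injective {xs} gf≡h u =
  Unique.map⁻ {f = g} (subst Unique (trans (sym (List.map-cong-local gf≡h)) (List.map-∘ xs))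
                                     (Unique.map⁺ h-injective u))

disjoint-map : ∀ {A B C : Set} {f : A → C} {g : B → C} {xs ys} → (∀ {a b} → f a ≢ g b) →
               Disjoint (map f xs) (map g ys)
disjoint-map {f = f} {g} f≢g (v∈fxs , v∈gys) with ∈-map⁻ f v∈fxs | ∈-map⁻ g v∈gys
... | _ , _ , refl | _ , _ , fa≡gb = f≢g fa≡gb

module _ {A B C : Set} (f : A → C → B) (codesOf : A → List C) (decode : B → Maybe (A × C)) where

  Decodes : A → Set
  Decodes x = All (λ c → decode (f x c) ≡ just (x , c)) (codesOf x)

  concatMap-decodable-unique : ∀ {xs} → Unique xs → All (λ x → Unique (codesOf x) × Decodes x) xs →
                               Unique (concatMap (λ x → map (f x) (codesOf x)) xs)
  concatMap-decodable-unique [] [] = []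
  concatMap-decodable-unique {x ∷ xs} (x∉xs ∷ u) ((ux , dx) ∷ ds) =
    Unique.++⁺ (unique-map-retraction decode (λ { refl → refl }) dx ux) (concatMap-decodable-unique u ds)
               disjoint
    where
      disjoint : Disjoint (map (f x) (codesOf x)) (concatMap (λ x → map (f x) (codesOf x)) xs)
      disjoint (v∈ , v∈′) with ∈-map⁻ (f x) v∈ | ∈-concat⁻′ (map (λ x → map (f x) (codesOf x)) xs) v∈′
      ... | c , c∈ , refl | ys , v∈ys , ys∈ with ∈-map⁻ (λ x → map (f x) (codesOf x)) ys∈
      ...   | x′ , x′∈ , refl with ∈-map⁻ (f x′) v∈ys
      ...     | c′ , c′∈ , fxc≡fx′c′ = All.lookup x∉xs x′∈ (first-components (begin
                just (x , c)      ≡⟨ All.lookup dx c∈ ⟨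
                decode (f x c)    ≡⟨ cong decode fxc≡fx′c′ ⟩
                decode (f x′ c′)  ≡⟨ All.lookup (proj₂ (All.lookup ds x′∈)) c′∈ ⟩
                just (x′ , c′)    ∎))
        where
          open ≡-Reasoning
          first-components : ∀ {a a′ : A} {b b′ : C} → just (a , b) ≡ just (a′ , b′) → a ≡ a′
          first-components refl = refl

+-pull-middle : ∀ a k b c → a + (k + b) + c ≡ k + (a + b + c)
+-pull-middle = solve 4 (λ a k b c → a :+ (k :+ b) :+ c := k :+ (a :+ b :+ c)) refl

+-pull-last : ∀ a b k c → a + b + (k + c) ≡ k + (a + b + c)
+-pull-last = solve 4 (λ a b k c → a :+ b :+ (k :+ c) := k :+ (a :+ b :+ c)) refl

<ᵇ-false : ∀ {a b} → b ≤ a → (a <ᵇ b) ≡ false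
<ᵇ-false {b = zero} _ = refl
<ᵇ-false (s≤s b≤a) = <ᵇ-false b≤a

<ᵇ-true : ∀ {a b} → a < b → (a <ᵇ b) ≡ true
<ᵇ-true {zero} (s≤s _) = refl
<ᵇ-true {suc a} (s≤s a<b) = <ᵇ-true a<b

-- Inserting a new largest label

βF≤ : ∀ j cs → βF j cs ≤ j
βF≤ j [] = ≤-refl
βF≤ j (c ∷ cs) = ≤-trans (m⊓n≤n (β c) (βF j cs)) (βF≤ j cs)

leaf : ℕ → PTree
leaf m = node m []

insertAt : ℕ → PTree → List PTree → List PTree
insertAt zero x cs = x ∷ cs
insertAt (suc i) x [] = x ∷ []
insertAt (suc i) x (c ∷ cs) = c ∷ insertAt i x cs

pushDown : ℕ → ℕ → List PTree → List PTree
pushDown zero j cs = node j cs ∷ []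
pushDown (suc i) j [] = node j [] ∷ []
pushDown (suc i) j (c ∷ cs) = c ∷ pushDown i j cs

data Way : Set where
  asLeaf asParent : Way

addVertex : ℕ → Way → ℕ → PTree → PTree
addVertex m asLeaf i (node j cs) = node j (insertAt i (leaf m) cs)
addVertex m asParent i (node j cs) = node m (pushDown i j cs)

-- gap i lies before the i-th child of the root (gap d after the last of d children); the gaps of
-- the other vertices are reached through the subtree containing them
mutual
  data Pos : Set where
    gap : ℕ → Pos
    below : ChildPos → Pos

  data ChildPos : Set where
    inHead : Pos → ChildPos
    inTail : ChildPos → ChildPos

mutual
  data Valid : Pos → PTree → Set where
    gap : ∀ {i j cs} → i ≤ length cs → Valid (gap i) (node j cs)
    below : ∀ {q j cs} → ValidF q cs → Valid (below q) (node j cs)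

  data ValidF : ChildPos → List PTree → Set where
    inHead : ∀ {p c cs} → Valid p c → ValidF (inHead p) (c ∷ cs)
    inTail : ∀ {q c cs} → ValidF q cs → ValidF (inTail q) (c ∷ cs)

mutual
  modifyAt : Pos → (ℕ → PTree → PTree) → PTree → PTree
  modifyAt (gap i) f T = f i T
  modifyAt (below q) f (node j cs) = node j (modifyF q f cs)

  modifyF : ChildPos → (ℕ → PTree → PTree) → List PTree → List PTree
  modifyF q f [] = []
  modifyF (inHead p) f (c ∷ cs) = modifyAt p f c ∷ cs
  modifyF (inTail q) f (c ∷ cs) = c ∷ modifyF q f cs

Code : Set
Code = Pos × Way

insert : ℕ → Code → PTree → PTree
insert m (p , w) = modifyAt p (addVertex m w)

Bounded : ℕ → PTree → Set
Bounded m T = All (_< m) (labels T)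

BoundedF : ℕ → List PTree → Set
BoundedF m cs = All (_< m) (labelsF cs)

boundedF-∷ : ∀ {m} c cs → BoundedF m (c ∷ cs) → Bounded m c × BoundedF m cs
boundedF-∷ c cs = All.++⁻ (labels c)

length-insertAt : ∀ i x cs → length (insertAt i x cs) ≡ suc (length cs)
length-insertAt zero x cs = refl
length-insertAt (suc i) x [] = refl
length-insertAt (suc i) x (c ∷ cs) = cong suc (length-insertAt i x cs)

length-modifyF : ∀ {f} q cs → length (modifyF q f cs) ≡ length cs
length-modifyF q [] = refl
length-modifyF (inHead p) (c ∷ cs) = refl
length-modifyF (inTail q) (c ∷ cs) = cong suc (length-modifyF q cs)

insertAt-labelsF : ∀ i x cs → labelsF (insertAt i x cs) ↭ labels x ++ labelsF cs
insertAt-labelsF zero x cs = ↭-refl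
insertAt-labelsF (suc i) x [] = ↭-refl
insertAt-labelsF (suc i) x (c ∷ cs) =
  ↭-trans (Perm.++⁺ˡ (labels c) (insertAt-labelsF i x cs)) (Perm.shifts (labels c) (labels x))

pushDown-labelsF : ∀ i j cs → labelsF (pushDown i j cs) ↭ j ∷ labelsF cs
pushDown-labelsF zero j cs = ↭-reflexive (List.++-identityʳ (j ∷ labelsF cs))
pushDown-labelsF (suc i) j [] = ↭-refl
pushDown-labelsF (suc i) j (c ∷ cs) =
  ↭-trans (Perm.++⁺ˡ (labels c) (pushDown-labelsF i j cs)) (Perm.shift j (labels c) (labelsF cs))

module _ {m : ℕ} where

  insertAt-βF : ∀ {j} i cs → j < m → βF j (insertAt i (leaf m) cs) ≡ βF j cs
  insertAt-βF zero cs j<m = m≥n⇒m⊓n≡n (≤-trans (βF≤ _ cs) (<⇒≤ j<m))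
  insertAt-βF (suc i) [] j<m = m≥n⇒m⊓n≡n (<⇒≤ j<m)
  insertAt-βF (suc i) (c ∷ cs) j<m = cong (β c ⊓_) (insertAt-βF i cs j<m)

  insertAt-impr : ∀ {j} i cs → j < m → imprF j (insertAt i (leaf m) cs) ≡ imprF j cs
  insertAt-impr zero cs j<m rewrite <ᵇ-false (≤-trans (βF≤ _ cs) (<⇒≤ j<m)) = refl
  insertAt-impr (suc i) [] j<m rewrite <ᵇ-false (<⇒≤ j<m) = refl
  insertAt-impr (suc i) (c ∷ cs) j<m rewrite insertAt-βF i cs j<m | insertAt-impr i cs j<m = refl

  insertAt-prop : ∀ {j} i cs → j < m → propF j (insertAt i (leaf m) cs) ≡ suc (propF j cs)
  insertAt-prop zero cs j<m rewrite <ᵇ-false (≤-trans (βF≤ _ cs) (<⇒≤ j<m)) = refl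
  insertAt-prop (suc i) [] j<m rewrite <ᵇ-false (<⇒≤ j<m) = refl
  insertAt-prop {j} (suc i) (c ∷ cs) j<m rewrite insertAt-βF i cs j<m | insertAt-prop i cs j<m =
    +-pull-last (if β c <ᵇ βF j cs then 0 else 1) (prop c) 1 (propF j cs)

  insertAt-increasing : ∀ {j} i cs → j < m → IncreasingF j (insertAt i (leaf m) cs) ⇔ IncreasingF j cs
  insertAt-increasing zero cs j<m = mk⇔ (proj₂ ∘ proj₂) (λ inc → j<m , tt , inc)
  insertAt-increasing (suc i) [] j<m = mk⇔ (const tt) (const (j<m , tt , tt))
  insertAt-increasing (suc i) (c ∷ cs) j<m = ⇔-id _ ×-⇔ ⇔-id _ ×-⇔ insertAt-increasing i cs j<m

  pushDown-βF : ∀ {j} i cs → j < m → βF m (pushDown i j cs) ≡ βF j cs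
  pushDown-βF zero cs j<m = m≤n⇒m⊓n≡m (≤-trans (βF≤ _ cs) (<⇒≤ j<m))
  pushDown-βF (suc i) [] j<m = m≤n⇒m⊓n≡m (<⇒≤ j<m)
  pushDown-βF (suc i) (c ∷ cs) j<m = cong (β c ⊓_) (pushDown-βF i cs j<m)

  pushDown-impr : ∀ {j} i cs → j < m → imprF m (pushDown i j cs) ≡ suc (imprF j cs)
  pushDown-impr zero cs j<m rewrite <ᵇ-true (≤-<-trans (βF≤ _ cs) j<m) = cong suc (+-identityʳ _)
  pushDown-impr (suc i) [] j<m rewrite <ᵇ-true j<m = refl
  pushDown-impr {j} (suc i) (c ∷ cs) j<m rewrite pushDown-βF i cs j<m | pushDown-impr i cs j<m =
    +-pull-last (if β c <ᵇ βF j cs then 1 else 0) (impr c) 1 (imprF j cs)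

  pushDown-prop : ∀ {j} i cs → j < m → propF m (pushDown i j cs) ≡ propF j cs
  pushDown-prop zero cs j<m rewrite <ᵇ-true (≤-<-trans (βF≤ _ cs) j<m) = +-identityʳ _
  pushDown-prop (suc i) [] j<m rewrite <ᵇ-true j<m = refl
  pushDown-prop (suc i) (c ∷ cs) j<m rewrite pushDown-βF i cs j<m | pushDown-prop i cs j<m = refl

  pushDown-¬increasing : ∀ {j} i cs → j < m → ¬ IncreasingF m (pushDown i j cs)
  pushDown-¬increasing zero cs j<m (m<j , _) = <-asym j<m m<j
  pushDown-¬increasing (suc i) [] j<m (m<j , _) = <-asym j<m m<j
  pushDown-¬increasing (suc i) (c ∷ cs) j<m (_ , _ , inc) = pushDown-¬increasing i cs j<m inc

  addVertex-β : ∀ w i S → Bounded m S → β (addVertex m w i S) ≡ β S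
  addVertex-β asLeaf i (node j cs) (j<m ∷ _) = insertAt-βF i cs j<m
  addVertex-β asParent i (node j cs) (j<m ∷ _) = pushDown-βF i cs j<m

  addVertex-labels : ∀ w i S → labels (addVertex m w i S) ↭ m ∷ labels S
  addVertex-labels asLeaf i (node j cs) = ↭-trans (prep j (insertAt-labelsF i (leaf m) cs)) (swap j m ↭-refl)
  addVertex-labels asParent i (node j cs) = prep m (pushDown-labelsF i j cs)

module _ {m : ℕ} {f : ℕ → PTree → PTree} where

  -- an edge outside the modified subtree sees that subtree only through its β
  module _ (f-β : ∀ i S → Bounded m S → β (f i S) ≡ β S) where

    mutual
      modifyAt-β : ∀ p T → Bounded m T → β (modifyAt p f T) ≡ β T
      modifyAt-β (gap i) T b = f-β i T b
      modifyAt-β (below q) (node j cs) (_ ∷ b) = modifyF-β q j cs b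

      modifyF-β : ∀ q j cs → BoundedF m cs → βF j (modifyF q f cs) ≡ βF j cs
      modifyF-β q j [] b = refl
      modifyF-β (inHead p) j (c ∷ cs) b = cong (_⊓ βF j cs) (modifyAt-β p c (proj₁ (boundedF-∷ c cs b)))
      modifyF-β (inTail q) j (c ∷ cs) b = cong (β c ⊓_) (modifyF-β q j cs (proj₂ (boundedF-∷ c cs b)))

    module _ (k : ℕ) (f-impr : ∀ i S → Bounded m S → impr (f i S) ≡ k + impr S) where

      mutual
        modifyAt-impr : ∀ {p T} → Valid p T → Bounded m T → impr (modifyAt p f T) ≡ k + impr T
        modifyAt-impr {gap i} {T} _ b = f-impr i T b
        modifyAt-impr (below v) (_ ∷ b) = modifyF-impr v b

        modifyF-impr : ∀ {q j cs} → ValidF q cs → BoundedF m cs → imprF j (modifyF q f cs) ≡ k + imprF j cs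
        modifyF-impr {inHead p} {j} {c ∷ cs} (inHead v) b
          rewrite modifyAt-β p c (proj₁ (boundedF-∷ c cs b)) | modifyAt-impr v (proj₁ (boundedF-∷ c cs b)) =
            +-pull-middle (if β c <ᵇ βF j cs then 1 else 0) k (impr c) (imprF j cs)
        modifyF-impr {inTail q} {j} {c ∷ cs} (inTail v) b
          rewrite modifyF-β q j cs (proj₂ (boundedF-∷ c cs b))
                | modifyF-impr {j = j} v (proj₂ (boundedF-∷ c cs b)) =
            +-pull-last (if β c <ᵇ βF j cs then 1 else 0) (impr c) k (imprF j cs)

    module _ (k : ℕ) (f-prop : ∀ i S → Bounded m S → prop (f i S) ≡ k + prop S) where

      mutual
        modifyAt-prop : ∀ {p T} → Valid p T → Bounded m T → prop (modifyAt p f T) ≡ k + prop T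
        modifyAt-prop {gap i} {T} _ b = f-prop i T b
        modifyAt-prop (below v) (_ ∷ b) = modifyF-prop v b

        modifyF-prop : ∀ {q j cs} → ValidF q cs → BoundedF m cs → propF j (modifyF q f cs) ≡ k + propF j cs
        modifyF-prop {inHead p} {j} {c ∷ cs} (inHead v) b
          rewrite modifyAt-β p c (proj₁ (boundedF-∷ c cs b)) | modifyAt-prop v (proj₁ (boundedF-∷ c cs b)) =
            +-pull-middle (if β c <ᵇ βF j cs then 0 else 1) k (prop c) (propF j cs)
        modifyF-prop {inTail q} {j} {c ∷ cs} (inTail v) b
          rewrite modifyF-β q j cs (proj₂ (boundedF-∷ c cs b))
                | modifyF-prop {j = j} v (proj₂ (boundedF-∷ c cs b)) =
            +-pull-last (if β c <ᵇ βF j cs then 0 else 1) (prop c) k (propF j cs)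

  module _ (f-labels : ∀ i S → labels (f i S) ↭ m ∷ labels S) where

    mutual
      modifyAt-labels : ∀ {p T} → Valid p T → labels (modifyAt p f T) ↭ m ∷ labels T
      modifyAt-labels {gap i} {T} _ = f-labels i T
      modifyAt-labels {T = node j cs} (below v) = ↭-trans (prep j (modifyF-labels v)) (swap j m ↭-refl)

      modifyF-labels : ∀ {q cs} → ValidF q cs → labelsF (modifyF q f cs) ↭ m ∷ labelsF cs
      modifyF-labels {cs = c ∷ cs} (inHead v) = Perm.++⁺ʳ (labelsF cs) (modifyAt-labels v)
      modifyF-labels {cs = c ∷ cs} (inTail v) =
        ↭-trans (Perm.++⁺ˡ (labels c) (modifyF-labels v)) (Perm.shift m (labels c) (labelsF cs))

  module _ (f-root : ∀ i S → rootLabel (f i S) ≡ rootLabel S)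
           (f-increasing : ∀ i S → Bounded m S → Increasing (f i S) ⇔ Increasing S) where

    modifyAt-rootLabel : ∀ p T → rootLabel (modifyAt p f T) ≡ rootLabel T
    modifyAt-rootLabel (gap i) T = f-root i T
    modifyAt-rootLabel (below q) (node j cs) = refl

    mutual
      modifyAt-increasing : ∀ p T → Bounded m T → Increasing (modifyAt p f T) ⇔ Increasing T
      modifyAt-increasing (gap i) T b = f-increasing i T b
      modifyAt-increasing (below q) (node j cs) (_ ∷ b) = modifyF-increasing q j cs b

      modifyF-increasing : ∀ q j cs → BoundedF m cs → IncreasingF j (modifyF q f cs) ⇔ IncreasingF j cs
      modifyF-increasing q j [] b = ⇔-id _
      modifyF-increasing (inHead p) j (c ∷ cs) b rewrite modifyAt-rootLabel p c =
        ⇔-id _ ×-⇔ modifyAt-increasing p c (proj₁ (boundedF-∷ c cs b)) ×-⇔ ⇔-id _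
      modifyF-increasing (inTail q) j (c ∷ cs) b =
        ⇔-id _ ×-⇔ ⇔-id _ ×-⇔ modifyF-increasing q j cs (proj₂ (boundedF-∷ c cs b))

  module _ (f-breaks : ∀ i S → Bounded m S → ¬ Increasing (f i S)) where

    mutual
      modifyAt-¬increasing : ∀ {p T} → Valid p T → Bounded m T → ¬ Increasing (modifyAt p f T)
      modifyAt-¬increasing {gap i} {T} _ b = f-breaks i T b
      modifyAt-¬increasing (below v) (_ ∷ b) = modifyF-¬increasing v b

      modifyF-¬increasing : ∀ {q j cs} → ValidF q cs → BoundedF m cs → ¬ IncreasingF j (modifyF q f cs)
      modifyF-¬increasing {cs = c ∷ cs} (inHead v) b (_ , inc , _) =
        modifyAt-¬increasing v (proj₁ (boundedF-∷ c cs b)) inc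
      modifyF-¬increasing {cs = c ∷ cs} (inTail v) b (_ , _ , inc) =
        modifyF-¬increasing v (proj₂ (boundedF-∷ c cs b)) inc

module _ {m : ℕ} where

  insert-labels : ∀ {p T} w → Valid p T → labels (insert m (p , w) T) ↭ m ∷ labels T
  insert-labels w = modifyAt-labels (addVertex-labels w)

  insert-asLeaf-impr : ∀ {p T} → Valid p T → Bounded m T → impr (insert m (p , asLeaf) T) ≡ impr T
  insert-asLeaf-impr = modifyAt-impr (addVertex-β asLeaf) 0 λ { i (node j cs) (j<m ∷ _) → insertAt-impr i cs j<m }

  insert-asLeaf-prop : ∀ {p T} → Valid p T → Bounded m T → prop (insert m (p , asLeaf) T) ≡ suc (prop T)
  insert-asLeaf-prop = modifyAt-prop (addVertex-β asLeaf) 1 λ { i (node j cs) (j<m ∷ _) → insertAt-prop i cs j<m }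

  insert-asParent-impr : ∀ {p T} → Valid p T → Bounded m T → impr (insert m (p , asParent) T) ≡ suc (impr T)
  insert-asParent-impr = modifyAt-impr (addVertex-β asParent) 1 λ { i (node j cs) (j<m ∷ _) → pushDown-impr i cs j<m }

  insert-asParent-prop : ∀ {p T} → Valid p T → Bounded m T → prop (insert m (p , asParent) T) ≡ prop T
  insert-asParent-prop = modifyAt-prop (addVertex-β asParent) 0 λ { i (node j cs) (j<m ∷ _) → pushDown-prop i cs j<m }

  insert-asLeaf-increasing : ∀ p T → Bounded m T → Increasing (insert m (p , asLeaf) T) ⇔ Increasing T
  insert-asLeaf-increasing = modifyAt-increasing (λ { i (node j cs) → refl })
    λ { i (node j cs) (j<m ∷ _) → insertAt-increasing i cs j<m }

  insert-asParent-¬increasing : ∀ {p T} → Valid p T → Bounded m T → ¬ Increasing (insert m (p , asParent) T)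
  insert-asParent-¬increasing = modifyAt-¬increasing λ { i (node j cs) (j<m ∷ _) → pushDown-¬increasing i cs j<m }

mutual
  positions : PTree → List Pos
  positions (node j cs) = map gap (upTo (suc (length cs))) ++ map below (childPositions cs)

  childPositions : List PTree → List ChildPos
  childPositions [] = []
  childPositions (c ∷ cs) = map inHead (positions c) ++ map inTail (childPositions cs)

codes : PTree → List Code
codes T = cartesianProduct (positions T) (asLeaf ∷ asParent ∷ [])

extensions : ℕ → PTree → List PTree
extensions m T = map (λ c → insert m c T) (codes T)

mutual
  positions-valid : ∀ T → All (λ p → Valid p T) (positions T)
  positions-valid (node j cs) = All.++⁺
    (All.map⁺ (All.tabulate (λ i∈ → gap (s≤s⁻¹ (∈-upTo⁻ i∈)))))
    (All.map⁺ (All.map below (childPositions-valid cs)))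

  childPositions-valid : ∀ cs → All (λ q → ValidF q cs) (childPositions cs)
  childPositions-valid [] = []
  childPositions-valid (c ∷ cs) = All.++⁺
    (All.map⁺ (All.map inHead (positions-valid c)))
    (All.map⁺ (All.map inTail (childPositions-valid cs)))

mutual
  valid⇒∈positions : ∀ {p T} → Valid p T → p ∈ positions T
  valid⇒∈positions (gap i≤d) = ∈-++⁺ˡ (∈-map⁺ gap (∈-upTo⁺ (s≤s i≤d)))
  valid⇒∈positions {T = node j cs} (below v) =
    ∈-++⁺ʳ (map gap (upTo (suc (length cs)))) (∈-map⁺ below (valid⇒∈childPositions v))

  valid⇒∈childPositions : ∀ {q cs} → ValidF q cs → q ∈ childPositions cs
  valid⇒∈childPositions (inHead v) = ∈-++⁺ˡ (∈-map⁺ inHead (valid⇒∈positions v))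
  valid⇒∈childPositions {cs = c ∷ cs} (inTail v) =
    ∈-++⁺ʳ (map inHead (positions c)) (∈-map⁺ inTail (valid⇒∈childPositions v))

mutual
  positions-unique : ∀ T → Unique (positions T)
  positions-unique (node j cs) = Unique.++⁺
    (Unique.map⁺ (λ { refl → refl }) (Unique.upTo⁺ _))
    (Unique.map⁺ (λ { refl → refl }) (childPositions-unique cs))
    (disjoint-map λ ())

  childPositions-unique : ∀ cs → Unique (childPositions cs)
  childPositions-unique [] = []
  childPositions-unique (c ∷ cs) = Unique.++⁺
    (Unique.map⁺ (λ { refl → refl }) (positions-unique c))
    (Unique.map⁺ (λ { refl → refl }) (childPositions-unique cs))
    (disjoint-map λ ())

codes-unique : ∀ T → Unique (codes T)
codes-unique T = Unique.cartesianProduct⁺ (positions-unique T) (((λ ()) ∷ []) ∷ [] ∷ [])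

mutual
  length-positions : ∀ T → suc (length (positions T)) ≡ 2 * length (labels T)
  length-positions (node j cs) = begin
      suc (length (map gap (upTo (suc d)) ++ map below (childPositions cs)))
        ≡⟨ cong suc (length-map-++ gap below (upTo (suc d)) (childPositions cs)) ⟩
      suc (length (upTo (suc d)) + length (childPositions cs))
        ≡⟨ cong (λ k → suc (k + length (childPositions cs))) (List.length-upTo (suc d)) ⟩
      2 + (d + length (childPositions cs))
        ≡⟨ cong (2 +_) (+-comm d (length (childPositions cs))) ⟩
      2 + (length (childPositions cs) + d)
        ≡⟨ cong (2 +_) (length-childPositions cs) ⟩
      2 + 2 * length (labelsF cs)
        ≡⟨ *-distribˡ-+ 2 1 (length (labelsF cs)) ⟨
      2 * length (labels (node j cs)) ∎
    where
      open ≡-Reasoning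
      d = length cs

  length-childPositions : ∀ cs → length (childPositions cs) + length cs ≡ 2 * length (labelsF cs)
  length-childPositions [] = refl
  length-childPositions (c ∷ cs) = begin
      length (map inHead (positions c) ++ map inTail (childPositions cs)) + suc (length cs)
        ≡⟨ cong (_+ suc (length cs)) (length-map-++ inHead inTail (positions c) (childPositions cs)) ⟩
      length (positions c) + length (childPositions cs) + suc (length cs)
        ≡⟨ trans (+-suc _ (length cs)) (cong suc (+-assoc (length (positions c)) _ _)) ⟩
      suc (length (positions c)) + (length (childPositions cs) + length cs)
        ≡⟨ cong₂ _+_ (length-positions c) (length-childPositions cs) ⟩
      2 * length (labels c) + 2 * length (labelsF cs)
        ≡⟨ *-distribˡ-+ 2 (length (labels c)) (length (labelsF cs)) ⟨
      2 * (length (labels c) + length (labelsF cs))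
        ≡⟨ cong (2 *_) (List.length-++ (labels c)) ⟨
      2 * length (labelsF (c ∷ cs)) ∎
    where open ≡-Reasoning

-- Removing the largest label

consChild : PTree → PTree → PTree
consChild c (node j cs) = node j (c ∷ cs)

shiftPos : Pos → Pos
shiftPos (gap i) = gap (suc i)
shiftPos (below q) = below (inTail q)

shiftPos-valid : ∀ {p j k c cs} → Valid p (node j cs) → Valid (shiftPos p) (node k (c ∷ cs))
shiftPos-valid (gap i≤d) = gap (s≤s i≤d)
shiftPos-valid (below v) = below (inTail v)

insert-shiftPos : ∀ m c p w j cs →
                  insert m (shiftPos p , w) (node j (c ∷ cs)) ≡ consChild c (insert m (p , w) (node j cs))
insert-shiftPos m c (gap i) asLeaf j cs = refl
insert-shiftPos m c (gap i) asParent j cs = refl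
insert-shiftPos m c (below q) w j cs = refl

adoptFirst : PTree → Maybe (ℕ × PTree) → Maybe (ℕ × PTree)
adoptFirst c nothing = just (0 , c)
adoptFirst c (just (i , node j ds)) = just (suc i , node j (c ∷ ds))

unpushDown : List PTree → Maybe (ℕ × PTree)
unpushDown [] = nothing
unpushDown (c ∷ cs) = adoptFirst c (unpushDown cs)

unpushDown-pushDown : ∀ i j cs → i ≤ length cs → unpushDown (pushDown i j cs) ≡ just (i , node j cs)
unpushDown-pushDown zero j cs _ = refl
unpushDown-pushDown (suc i) j (c ∷ cs) (s≤s i≤d) rewrite unpushDown-pushDown i j cs i≤d = refl

pushDown-length : ∀ xs k ds → pushDown (length xs) k (xs ++ ds) ≡ xs ∷ʳ node k ds
pushDown-length [] k ds = refl
pushDown-length (x ∷ xs) k ds = cong (x ∷_) (pushDown-length xs k ds)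

module _ (m : ℕ) where

  mutual
    uninsert : PTree → Maybe (PTree × Code)
    uninsert (node j cs) with j ≟ m
    ... | yes _ = Maybe.map (λ (i , T) → T , gap i , asParent) (unpushDown cs)
    ... | no _ = Maybe.map (λ (cs₀ , c) → node j cs₀ , c) (uninsertF cs)

    uninsertF : List PTree → Maybe (List PTree × Code)
    uninsertF [] = nothing
    uninsertF (c ∷ cs) = uninsertChild c cs (uninsert c)

    uninsertChild : PTree → List PTree → Maybe (PTree × Code) → Maybe (List PTree × Code)
    uninsertChild c cs (just (c₀ , p , w)) = just (c₀ ∷ cs , below (inHead p) , w)
    uninsertChild (node k ds) cs nothing with k ≟ m
    ... | yes _ = just (cs , gap 0 , asLeaf) -- a child m from which nothing can be removed is a leaf
    ... | no _ = Maybe.map (λ (cs₀ , p , w) → node k ds ∷ cs₀ , shiftPos p , w) (uninsertF cs)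

  mutual
    uninsert-fresh : ∀ T → Bounded m T → uninsert T ≡ nothing
    uninsert-fresh (node j cs) (j<m ∷ b) rewrite dec-no (j ≟ m) (<⇒≢ j<m) | uninsertF-fresh cs b = refl

    uninsertF-fresh : ∀ cs → BoundedF m cs → uninsertF cs ≡ nothing
    uninsertF-fresh [] _ = refl
    uninsertF-fresh (node k ds ∷ cs) b@(k<m ∷ _)
      rewrite uninsert-fresh (node k ds) (proj₁ (boundedF-∷ (node k ds) cs b)) | dec-no (k ≟ m) (<⇒≢ k<m)
            | uninsertF-fresh cs (proj₂ (boundedF-∷ (node k ds) cs b)) = refl

  uninsert-leaf : uninsert (leaf m) ≡ nothing
  uninsert-leaf rewrite ≟-diag (refl {x = m}) = refl

  uninsertF-insertAt : ∀ i cs → i ≤ length cs → BoundedF m cs →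
                       uninsertF (insertAt i (leaf m) cs) ≡ just (cs , gap i , asLeaf)
  uninsertF-insertAt zero cs _ _ rewrite uninsert-leaf | ≟-diag (refl {x = m}) = refl
  uninsertF-insertAt (suc i) (node k ds ∷ cs) (s≤s i≤d) b@(k<m ∷ _)
    rewrite uninsert-fresh (node k ds) (proj₁ (boundedF-∷ (node k ds) cs b)) | dec-no (k ≟ m) (<⇒≢ k<m)
          | uninsertF-insertAt i cs i≤d (proj₂ (boundedF-∷ (node k ds) cs b)) = refl

  mutual
    uninsert-insert : ∀ {p T} w → Valid p T → Bounded m T → uninsert (insert m (p , w) T) ≡ just (T , p , w)
    uninsert-insert {gap i} {node j cs} asLeaf (gap i≤d) (j<m ∷ b)
      rewrite dec-no (j ≟ m) (<⇒≢ j<m) | uninsertF-insertAt i cs i≤d b = refl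
    uninsert-insert {gap i} {node j cs} asParent (gap i≤d) _
      rewrite ≟-diag (refl {x = m}) | unpushDown-pushDown i j cs i≤d = refl
    uninsert-insert {below q} {node j cs} w (below v) (j<m ∷ b)
      rewrite dec-no (j ≟ m) (<⇒≢ j<m) | uninsertF-insert w v b = refl

    uninsertF-insert : ∀ {q cs} w → ValidF q cs → BoundedF m cs →
                      uninsertF (modifyF q (addVertex m w) cs) ≡ just (cs , below q , w)
    uninsertF-insert {cs = c ∷ cs} w (inHead v) b rewrite uninsert-insert w v (proj₁ (boundedF-∷ c cs b)) = refl
    uninsertF-insert {cs = node k ds ∷ cs} w (inTail v) b@(k<m ∷ _)
      rewrite uninsert-fresh (node k ds) (proj₁ (boundedF-∷ (node k ds) cs b)) | dec-no (k ≟ m) (<⇒≢ k<m)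
            | uninsertF-insert w v (proj₂ (boundedF-∷ (node k ds) cs b)) = refl

  Preimage : PTree → Set
  Preimage T = ∃[ T₀ ] ∃[ c ] Valid (proj₁ c) T₀ × T ≡ insert m c T₀

  -- stated for every root label j, which the insertions found inside a child list never change
  ChildrenPreimage : List PTree → Set
  ChildrenPreimage cs =
    ∃[ cs₀ ] ∃[ c ] ∀ {j} → Valid (proj₁ c) (node j cs₀) × node j cs ≡ insert m c (node j cs₀)

  mutual
    preimage : ∀ T → m ∈ labels T → T ≡ leaf m ⊎ Preimage T
    preimage (node j cs) (here refl) with initLast cs
    ... | [] = inj₁ refl
    ... | xs ∷ʳ′ node k ds = inj₂ (node k (xs ++ ds) , (gap (length xs) , asParent) ,
            gap (≤-trans (m≤m+n (length xs) (length ds)) (≤-reflexive (sym (List.length-++ xs)))) ,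
            cong (node m) (sym (pushDown-length xs k ds)))
    preimage (node j cs) (there m∈) with childrenPreimage cs m∈
    ... | cs₀ , c , pre = inj₂ (node j cs₀ , c , pre)

    childrenPreimage : ∀ cs → m ∈ labelsF cs → ChildrenPreimage cs
    childrenPreimage (c ∷ cs) m∈ with ∈-++⁻ (labels c) m∈
    ... | inj₁ m∈c with preimage c m∈c
    ...   | inj₁ refl = cs , (gap 0 , asLeaf) , (gap z≤n , refl)
    ...   | inj₂ (c₀ , (p , w) , v , refl) = c₀ ∷ cs , (below (inHead p) , w) , (below (inHead v) , refl)
    childrenPreimage (c ∷ cs) m∈ | inj₂ m∈cs with childrenPreimage cs m∈cs
    ... | cs₀ , (p , w) , pre = c ∷ cs₀ , (shiftPos p , w) , λ {j} →
          shiftPos-valid (proj₁ (pre {j})) ,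
          trans (cong (consChild c) (proj₂ (pre {j}))) (sym (insert-shiftPos m c p w j cs₀))

-- Enumerating labeled plane trees

oneTo-suc : ∀ k → oneTo (suc k) ↭ suc k ∷ oneTo k
oneTo-suc k = ↭-trans (↭-reflexive (trans (cong (map suc) (sym (List.upTo-∷ʳ k))) (List.map-++ suc (upTo k) [ k ])))
                      (↭-sym (Perm.∷↭∷ʳ (suc k) (oneTo k)))

length-oneTo : ∀ k → length (oneTo k) ≡ k
length-oneTo k = trans (List.length-map suc (upTo k)) (List.length-upTo k)

module _ {n : ℕ} (T : PTree) (lp : LabeledPlane n T) where

  labeledPlane-size : length (labels T) ≡ suc n
  labeledPlane-size = trans (Perm.↭-length lp) (length-oneTo (suc n))

  labeledPlane-bounded : Bounded (2 + n) T
  labeledPlane-bounded = Perm.All-resp-↭ (↭-sym lp) (All.map⁺ (All.tabulate (λ i∈ → s≤s (∈-upTo⁻ i∈))))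

  labeledPlane-positive : All (1 ≤_) (labels T)
  labeledPlane-positive = Perm.All-resp-↭ (↭-sym lp) (All.map⁺ (All.tabulate (λ _ → s≤s z≤n)))

codes-valid : ∀ {T c} → c ∈ codes T → Valid (proj₁ c) T
codes-valid {T} c∈ = All.lookup (positions-valid T) (proj₁ (∈-cartesianProduct⁻ (positions T) _ c∈))

∈-codes : ∀ {p T} w → Valid p T → (p , w) ∈ codes T
∈-codes asLeaf v = ∈-cartesianProduct⁺ (valid⇒∈positions v) (here refl)
∈-codes asParent v = ∈-cartesianProduct⁺ (valid⇒∈positions v) (there (here refl))

allTrees : ℕ → List PTree
allTrees zero = leaf 1 ∷ []
allTrees (suc n) = concatMap (extensions (2 + n)) (allTrees n)

allTrees-sound : ∀ n → All (LabeledPlane n) (allTrees n)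
allTrees-sound zero = ↭-refl ∷ []
allTrees-sound (suc n) = All.concat⁺ (All.map⁺ (All.map extensions-sound (allTrees-sound n)))
  where
    extensions-sound : ∀ {T} → LabeledPlane n T → All (LabeledPlane (suc n)) (extensions (2 + n) T)
    extensions-sound lp = All.map⁺ (All.tabulate λ {c} c∈ →
      ↭-trans (insert-labels (proj₂ c) (codes-valid c∈)) (↭-trans (prep _ lp) (↭-sym (oneTo-suc (suc n)))))

allTrees-unique : ∀ n → Unique (allTrees n)
allTrees-unique zero = [] ∷ []
allTrees-unique (suc n) =
  concatMap-decodable-unique (λ T c → insert (2 + n) c T) codes (uninsert (2 + n)) (allTrees-unique n)
  (All.map (λ {T} lp → codes-unique T , All.tabulate λ {c} c∈ →
                        uninsert-insert (2 + n) (proj₂ c) (codes-valid c∈) (labeledPlane-bounded T lp))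
           (allTrees-sound n))

allTrees-complete : ∀ n {T} → LabeledPlane n T → T ∈ allTrees n
allTrees-complete zero {node j []} lp with Perm.∈-resp-↭ lp (here refl)
... | here refl = here refl
allTrees-complete zero {node j (node k ds ∷ cs)} lp with labeledPlane-size (node j (node k ds ∷ cs)) lp
... | ()
allTrees-complete (suc n) {T} lp with preimage (2 + n) T (Perm.∈-resp-↭ (↭-sym (↭-trans lp (oneTo-suc (suc n))))
                                                                         (here refl))
... | inj₁ refl with labeledPlane-size (leaf (2 + n)) lp
...   | ()
allTrees-complete (suc n) {T} lp | inj₂ (T₀ , (p , w) , v , refl) =
  ∈-concat⁺′ (∈-map⁺ (λ c → insert (2 + n) c T₀) (∈-codes w v))
             (∈-map⁺ (extensions (2 + n)) (allTrees-complete n lp₀))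
  where
    lp₀ : LabeledPlane n T₀
    lp₀ = Perm.drop-∷ (↭-trans (↭-sym (insert-labels w v)) (↭-trans lp (oneTo-suc (suc n))))

allTrees-enumerates : ∀ n → Enumerates (LabeledPlane n) (allTrees n)
allTrees-enumerates n = allTrees-unique n , λ T → mk⇔ (All.lookup (allTrees-sound n)) (allTrees-complete n)

enumerations-↭ : ∀ {P : PTree → Set} {L₁ L₂} → Enumerates P L₁ → Enumerates P L₂ → L₁ ↭ L₂
enumerations-↭ (u₁ , e₁) (u₂ , e₂) = unique-⇔⇒↭ u₁ u₂ λ {T} →
  mk⇔ (Equivalence.from (e₂ T) ∘ Equivalence.to (e₁ T)) (Equivalence.from (e₁ T) ∘ Equivalence.to (e₂ T))

filter-enumerates : ∀ {P Q : PTree → Set} (Q? : Decidable Q) {L} → Enumerates P L →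
                    Enumerates (λ T → P T × Q T) (filter Q? L)
filter-enumerates Q? (u , e) = Unique.filter⁺ Q? u , λ T → mk⇔
  (λ T∈ → let (T∈L , qT) = ∈-filter⁻ Q? T∈ in Equivalence.to (e T) T∈L , qT)
  (λ (pT , qT) → ∈-filter⁺ Q? (Equivalence.from (e T) pT) qT)

-- Weight sums over extensions

labeledPlane-positions : ∀ {n} T → LabeledPlane n T → length (positions T) ≡ 2 * n + 1
labeledPlane-positions {n} T lp = suc-injective (begin
    suc (length (positions T))  ≡⟨ length-positions T ⟩
    2 * length (labels T)       ≡⟨ cong (2 *_) (labeledPlane-size T lp) ⟩
    2 * suc n                   ≡⟨ solve 1 (λ n → con 2 :* (con 1 :+ n) := con 1 :+ (con 2 :* n :+ con 1)) refl n ⟩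
    suc (2 * n + 1)             ∎)
  where open ≡-Reasoning

module _ (m : ℕ) where

  bothWays : (PTree → ℕ) → PTree → Pos → ℕ
  bothWays h T p = sum (map (λ w → h (insert m (p , w) T)) (asLeaf ∷ asParent ∷ []))

  extensions-sum : ∀ h T → sum (map h (extensions m T)) ≡ sum (map (bothWays h T) (positions T))
  extensions-sum h T =
    trans (sum-map-∘ h (λ c → insert m c T) (codes T))
          (sum-cartesianProduct (λ c → h (insert m c T)) (positions T) _)

  extensions-sum-const : ∀ h T {a} → (∀ p → Valid p T → bothWays h T p ≡ a) →
                         sum (map h (extensions m T)) ≡ length (positions T) * a
  extensions-sum-const h T {a} eval = begin
      sum (map h (extensions m T))              ≡⟨ extensions-sum h T ⟩
      sum (map (bothWays h T) (positions T))
        ≡⟨ cong sum (List.map-cong-local (All.map (eval _) (positions-valid T))) ⟩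
      sum (map (λ _ → a) (positions T))         ≡⟨ sum-const a (positions T) ⟩
      length (positions T) * a                  ∎
    where open ≡-Reasoning

  extensions-sum-node : ∀ h j cs {a b} → let T = node j cs in
    (∀ i → i ≤ length cs → bothWays h T (gap i) ≡ a) →
    (∀ q → ValidF q cs → bothWays h T (below q) ≡ b) →
    sum (map h (extensions m T)) ≡ suc (length cs) * a + length (childPositions cs) * b
  extensions-sum-node h j cs {a} {b} evalGap evalBelow = begin
      sum (map h (extensions m T))
        ≡⟨ extensions-sum h T ⟩
      sum (map (bothWays h T) (map gap (upTo (suc d)) ++ map below (childPositions cs)))
        ≡⟨ cong sum (List.map-++ (bothWays h T) (map gap (upTo (suc d))) _) ⟩
      sum (map (bothWays h T) (map gap (upTo (suc d))) ++ map (bothWays h T) (map below (childPositions cs)))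
        ≡⟨ sum-++ (map (bothWays h T) (map gap (upTo (suc d)))) _ ⟩
      sum (map (bothWays h T) (map gap (upTo (suc d)))) + sum (map (bothWays h T) (map below (childPositions cs)))
        ≡⟨ cong₂ _+_ (sum-map-∘ (bothWays h T) gap (upTo (suc d)))
                     (sum-map-∘ (bothWays h T) below (childPositions cs)) ⟩
      sum (map (bothWays h T ∘ gap) (upTo (suc d))) + sum (map (bothWays h T ∘ below) (childPositions cs))
        ≡⟨ cong₂ _+_ (cong sum (List.map-cong-local (All.tabulate λ i∈ → evalGap _ (s≤s⁻¹ (∈-upTo⁻ i∈)))))
                     (cong sum (List.map-cong-local (All.map (evalBelow _) (childPositions-valid cs)))) ⟩
      sum (map (λ _ → a) (upTo (suc d))) + sum (map (λ _ → b) (childPositions cs))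
        ≡⟨ cong₂ _+_ (trans (sum-const a (upTo (suc d))) (cong (_* a) (List.length-upTo (suc d))))
                     (sum-const b (childPositions cs)) ⟩
      suc d * a + length (childPositions cs) * b ∎
    where
      open ≡-Reasoning
      T = node j cs
      d = length cs

module _ (x y : ℕ) where

  bothWays-wP : ∀ m {p T} → Valid p T → Bounded m T → bothWays m (wP x y) T p ≡ (x + y) * wP x y T
  bothWays-wP m {p} {T} v b
    rewrite insert-asLeaf-impr {m} v b | insert-asLeaf-prop {m} v b
          | insert-asParent-impr {m} v b | insert-asParent-prop {m} v b =
      solve 4 (λ x y a b → a :* (y :* b) :+ (x :* a :* b :+ con 0) := (x :+ y) :* (a :* b))
            refl x y (x ^ impr T) (y ^ prop T)

  Psum-allTrees : ∀ n → Psum x y (allTrees n) ≡ oddFact n * (x + y) ^ n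
  Psum-allTrees zero = refl
  Psum-allTrees (suc n) = begin
      sum (map (wP x y) (concatMap (extensions (2 + n)) (allTrees n)))
        ≡⟨ sum-concatMap (wP x y) (extensions (2 + n)) (allTrees n) ⟩
      sum (map (λ T → sum (map (wP x y) (extensions (2 + n) T))) (allTrees n))
        ≡⟨ cong sum (List.map-cong-local (All.map extensions-wP (allTrees-sound n))) ⟩
      sum (map (λ T → (2 * n + 1) * ((x + y) * wP x y T)) (allTrees n))
        ≡⟨ sum-*ˡ (2 * n + 1) _ (allTrees n) ⟩
      (2 * n + 1) * sum (map (λ T → (x + y) * wP x y T) (allTrees n))
        ≡⟨ cong ((2 * n + 1) *_) (trans (sum-*ˡ (x + y) (wP x y) (allTrees n))
                                        (cong ((x + y) *_) (Psum-allTrees n))) ⟩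
      (2 * n + 1) * ((x + y) * (oddFact n * (x + y) ^ n))
        ≡⟨ solve 4 (λ a s o q → a :* (s :* (o :* q)) := a :* o :* (s :* q))
                   refl (2 * n + 1) (x + y) (oddFact n) ((x + y) ^ n) ⟩
      (2 * n + 1) * oddFact n * ((x + y) * (x + y) ^ n) ∎
    where
      open ≡-Reasoning
      extensions-wP : ∀ {T} → LabeledPlane n T →
                      sum (map (wP x y) (extensions (2 + n) T)) ≡ (2 * n + 1) * ((x + y) * wP x y T)
      extensions-wP {T} lp = begin
          sum (map (wP x y) (extensions (2 + n) T))
            ≡⟨ extensions-sum-const (2 + n) (wP x y) T (λ p v → bothWays-wP (2 + n) v (labeledPlane-bounded T lp)) ⟩
          length (positions T) * ((x + y) * wP x y T)
            ≡⟨ cong (_* ((x + y) * wP x y T)) (labeledPlane-positions T lp) ⟩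
          (2 * n + 1) * ((x + y) * wP x y T) ∎

length≤labelsF : ∀ cs → length cs ≤ length (labelsF cs)
length≤labelsF [] = z≤n
length≤labelsF (node k ds ∷ cs) = s≤s (begin
    length cs                                 ≤⟨ length≤labelsF cs ⟩
    length (labelsF cs)                       ≤⟨ m≤n+m _ (length (labelsF ds)) ⟩
    length (labelsF ds) + length (labelsF cs) ≡⟨ List.length-++ (labelsF ds) ⟨
    length (labelsF ds ++ labelsF cs)         ∎)
  where open ≤-Reasoning

mutual
  β-lower : ∀ {k} T → All (k ≤_) (labels T) → k ≤ β T
  β-lower (node j cs) (k≤j ∷ a) = βF-lower cs k≤j a

  βF-lower : ∀ {k j} cs → k ≤ j → All (k ≤_) (labelsF cs) → k ≤ βF j cs
  βF-lower [] k≤j _ = k≤j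
  βF-lower (c ∷ cs) k≤j a =
    ⊓-glb (β-lower c (proj₁ (All.++⁻ (labels c) a))) (βF-lower cs k≤j (proj₂ (All.++⁻ (labels c) a)))

-- every edge at the root 1 is proper, as no subtree has β below 1; so prop ∸ rootDeg in wO is exact
rootDeg≤prop : ∀ cs → All (1 ≤_) (labelsF cs) → length cs ≤ propF 1 cs
rootDeg≤prop [] _ = z≤n
rootDeg≤prop (c ∷ cs) a rewrite <ᵇ-false (≤-trans (βF≤ 1 cs) (β-lower c (proj₁ (All.++⁻ (labels c) a)))) =
  s≤s (≤-trans (rootDeg≤prop cs (proj₂ (All.++⁻ (labels c) a))) (m≤n+m (propF 1 cs) (prop c)))

module _ {n : ℕ} (j : ℕ) (cs : List PTree) (lp : LabeledPlane n (node j cs)) where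

  private
    labelsF-size : length (labelsF cs) ≡ n
    labelsF-size = suc-injective (labeledPlane-size (node j cs) lp)

  labeledPlane-rootDeg≤ : length cs ≤ n
  labeledPlane-rootDeg≤ = ≤-trans (length≤labelsF cs) (≤-reflexive labelsF-size)

  labeledPlane-childPositions : length (childPositions cs) ≡ 2 * n ∸ length cs
  labeledPlane-childPositions = begin
      length (childPositions cs)                           ≡⟨ m+n∸n≡m _ (length cs) ⟨
      length (childPositions cs) + length cs ∸ length cs  ≡⟨ cong (_∸ length cs) (length-childPositions cs) ⟩
      2 * length (labelsF cs) ∸ length cs                 ≡⟨ cong (λ k → 2 * k ∸ length cs) labelsF-size ⟩
      2 * n ∸ length cs                                   ∎
    where open ≡-Reasoning

mutual
  increasing? : ∀ T → Dec (Increasing T)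
  increasing? (node j cs) = increasingF? j cs

  increasingF? : ∀ j cs → Dec (IncreasingF j cs)
  increasingF? j [] = yes tt
  increasingF? j (c ∷ cs) = (j <? rootLabel c) ×-dec (increasing? c ×-dec increasingF? j cs)

module _ (x y : ℕ) where

  weightO : (ℕ → ℕ) → PTree → ℕ
  weightO F T = if does (rootLabel T ≟ 1) then x ^ impr T * y ^ (prop T ∸ rootDeg T) * F (rootDeg T) else 0

  weightI : ℕ → (ℕ → ℕ) → PTree → ℕ
  weightI n F T = if does (increasing? T) then (x + y) ^ (n ∸ rootDeg T) * F (rootDeg T) else 0

  -- the d + 1 gaps at the root raise the root degree, the 2n - d other gaps contribute x + y
  transfer : ℕ → (ℕ → ℕ) → ℕ → ℕ
  transfer n F d = suc d * F (suc d) + (2 * n ∸ d) * ((x + y) * F d)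

  transfer-collect : ∀ n F d w → suc d * (w * F (suc d)) + (2 * n ∸ d) * ((x + y) * (w * F d)) ≡ w * transfer n F d
  transfer-collect n F d w =
    solve 6 (λ sd c s w fs fd → sd :* (w :* fs) :+ c :* (s :* (w :* fd)) := w :* (sd :* fs :+ c :* (s :* fd)))
          refl (suc d) (2 * n ∸ d) (x + y) w (F (suc d)) (F d)

  transfer-weightO : ∀ n F T → LabeledPlane n T →
                     sum (map (weightO F) (extensions (2 + n) T)) ≡ weightO (transfer n F) T
  transfer-weightO n F (node zero cs) _ =
    trans (extensions-sum-node (2 + n) (weightO F) zero cs (λ _ _ → refl) (λ _ _ → refl))
          (cong₂ _+_ (*-zeroʳ (suc (length cs))) (*-zeroʳ (length (childPositions cs))))
  transfer-weightO n F (node (suc (suc k)) cs) _ =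
    trans (extensions-sum-node (2 + n) (weightO F) (suc (suc k)) cs (λ _ _ → refl) (λ _ _ → refl))
          (cong₂ _+_ (*-zeroʳ (suc (length cs))) (*-zeroʳ (length (childPositions cs))))
  transfer-weightO n F (node 1 cs) lp = begin
      sum (map (weightO F) (extensions m T))
        ≡⟨ extensions-sum-node m (weightO F) 1 cs (λ i _ → evalGap i) evalBelow ⟩
      suc d * (W * F (suc d)) + length (childPositions cs) * ((x + y) * (W * F d))
        ≡⟨ cong (λ k → suc d * (W * F (suc d)) + k * ((x + y) * (W * F d))) (labeledPlane-childPositions 1 cs lp) ⟩
      suc d * (W * F (suc d)) + (2 * n ∸ d) * ((x + y) * (W * F d))
        ≡⟨ transfer-collect n F d W ⟩
      W * transfer n F d ∎
    where
      open ≡-Reasoning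
      m = 2 + n
      T = node 1 cs
      d = length cs
      W = x ^ imprF 1 cs * y ^ (propF 1 cs ∸ d)
      bd : Bounded m T
      bd = labeledPlane-bounded T lp
      1<m : 1 < m
      1<m = s≤s (s≤s z≤n)
      evalGap : ∀ i → bothWays m (weightO F) T (gap i) ≡ W * F (suc d)
      evalGap i rewrite insertAt-impr {m} i cs 1<m | insertAt-prop {m} i cs 1<m | length-insertAt i (leaf m) cs =
        +-identityʳ _
      evalBelow : ∀ q → ValidF q cs → bothWays m (weightO F) T (below q) ≡ (x + y) * (W * F d)
      evalBelow q v
        rewrite insert-asLeaf-impr {m} (below v) bd | insert-asLeaf-prop {m} (below v) bd
              | insert-asParent-impr {m} (below v) bd | insert-asParent-prop {m} (below v) bd
              | length-modifyF {f = addVertex m asLeaf} q cs | length-modifyF {f = addVertex m asParent} q cs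
              | +-∸-assoc 1 (rootDeg≤prop cs (All.tail (labeledPlane-positive T lp))) =
          solve 5 (λ x y a b f → a :* (y :* b) :* f :+ (x :* a :* b :* f :+ con 0) := (x :+ y) :* (a :* b :* f))
                refl x y (x ^ imprF 1 cs) (y ^ (propF 1 cs ∸ d)) (F d)

  transfer-weightI : ∀ n F T → LabeledPlane n T →
                     sum (map (weightI (suc n) F) (extensions (2 + n) T)) ≡ weightI n (transfer n F) T
  transfer-weightI n F (node j cs) lp = begin
      sum (map (weightI (suc n) F) (extensions m T))
        ≡⟨ extensions-sum-node m (weightI (suc n) F) j cs evalGap evalBelow ⟩
      suc d * when (Q * F (suc d)) + length (childPositions cs) * when ((x + y) * (Q * F d))
        ≡⟨ cong (λ k → suc d * when (Q * F (suc d)) + k * when ((x + y) * (Q * F d)))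
                (labeledPlane-childPositions j cs lp) ⟩
      suc d * when (Q * F (suc d)) + (2 * n ∸ d) * when ((x + y) * (Q * F d))
        ≡⟨ collect b ⟩
      when (Q * transfer n F d) ∎
    where
      open ≡-Reasoning
      m = 2 + n
      T = node j cs
      d = length cs
      b = does (increasing? T)
      Q = (x + y) ^ (n ∸ d)
      when : ℕ → ℕ
      when u = if b then u else 0
      bd : Bounded m T
      bd = labeledPlane-bounded T lp
      collect : ∀ b → suc d * (if b then Q * F (suc d) else 0) + (2 * n ∸ d) * (if b then (x + y) * (Q * F d) else 0)
                    ≡ (if b then Q * transfer n F d else 0)
      collect false = cong₂ _+_ (*-zeroʳ (suc d)) (*-zeroʳ (2 * n ∸ d))
      collect true = transfer-collect n F d Q
      asLeaf-increasing : ∀ p → does (increasing? (insert m (p , asLeaf) T)) ≡ b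
      asLeaf-increasing p =
        does-⇔ (insert-asLeaf-increasing p T bd) (increasing? (insert m (p , asLeaf) T)) (increasing? T)
      asParent-¬increasing : ∀ {p} → Valid p T → does (increasing? (insert m (p , asParent) T)) ≡ false
      asParent-¬increasing {p} v = dec-false (increasing? (insert m (p , asParent) T)) (insert-asParent-¬increasing v bd)
      evalGap : ∀ i → i ≤ d → bothWays m (weightI (suc n) F) T (gap i) ≡ when (Q * F (suc d))
      evalGap i i≤d rewrite asLeaf-increasing (gap i) | asParent-¬increasing (gap i≤d) | length-insertAt i (leaf m) cs =
        +-identityʳ _
      evalBelow : ∀ q → ValidF q cs → bothWays m (weightI (suc n) F) T (below q) ≡ when ((x + y) * (Q * F d))
      evalBelow q v rewrite asLeaf-increasing (below q) | asParent-¬increasing (below v)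
                          | length-modifyF {addVertex m asLeaf} q cs | +-∸-assoc 1 (labeledPlane-rootDeg≤ j cs lp) =
        trans (+-identityʳ _) (cong when (*-assoc (x + y) Q (F d)))

  weightO≡weightI : ∀ n F → sum (map (weightO F) (allTrees n)) ≡ sum (map (weightI n F) (allTrees n))
  weightO≡weightI zero F = refl
  weightO≡weightI (suc n) F = begin
      sum (map (weightO F) (concatMap (extensions (2 + n)) (allTrees n)))
        ≡⟨ sum-concatMap (weightO F) (extensions (2 + n)) (allTrees n) ⟩
      sum (map (λ T → sum (map (weightO F) (extensions (2 + n) T))) (allTrees n))
        ≡⟨ cong sum (List.map-cong-local (All.map (transfer-weightO n F _) (allTrees-sound n))) ⟩
      sum (map (weightO (transfer n F)) (allTrees n))
        ≡⟨ weightO≡weightI n (transfer n F) ⟩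
      sum (map (weightI n (transfer n F)) (allTrees n))
        ≡⟨ cong sum (List.map-cong-local (All.map (transfer-weightI n F _) (allTrees-sound n))) ⟨
      sum (map (λ T → sum (map (weightI (suc n) F) (extensions (2 + n) T))) (allTrees n))
        ≡⟨ sum-concatMap (weightI (suc n) F) (extensions (2 + n)) (allTrees n) ⟨
      sum (map (weightI (suc n) F) (concatMap (extensions (2 + n)) (allTrees n))) ∎
    where open ≡-Reasoning

oneTo-unique : ∀ n → Unique (oneTo n)
oneTo-unique n = Unique.map⁺ suc-injective (Unique.upTo⁺ n)

rootDeg∈oneTo : ∀ {n} T → 1 ≤ n → LabeledPlane n T → rootDeg T ∈ oneTo n
rootDeg∈oneTo (node j []) 1≤n lp with labeledPlane-size (node j []) lp
rootDeg∈oneTo (node j []) () lp | refl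
rootDeg∈oneTo (node j (c ∷ cs)) 1≤n lp = ∈-map⁺ suc (∈-upTo⁺ (labeledPlane-rootDeg≤ j (c ∷ cs) lp))

Orhs-as-sum : ∀ n x y t LI → All (λ T → rootDeg T ∈ oneTo n) LI →
              Orhs n x y t LI ≡ sum (map (λ T → (x + y) ^ (n ∸ rootDeg T) * t ^ rootDeg T) LI)
Orhs-as-sum n x y t LI degs = trans (cong sum (List.map-cong reorder (oneTo n)))
                                    (sum-fibres (λ r → (x + y) ^ (n ∸ r) * t ^ r) rootDeg (oneTo-unique n) LI degs)
  where
    reorder : ∀ r → t ^ r * Scount LI r * (x + y) ^ (n ∸ r) ≡ Scount LI r * ((x + y) ^ (n ∸ r) * t ^ r)
    reorder r = solve 3 (λ a s b → a :* s :* b := s :* (b :* a)) refl (t ^ r) (Scount LI r) ((x + y) ^ (n ∸ r))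

module _ {n : ℕ} (x y t : ℕ) where

  Osum-allTrees : ∀ {LO} → Enumerates (λ T → LabeledPlane n T × rootLabel T ≡ 1) LO →
                  Osum x y t LO ≡ sum (map (weightO x y (t ^_)) (allTrees n))
  Osum-allTrees {LO} eO = begin
      Osum x y t LO
        ≡⟨ sum-map-↭ (wO x y t) (enumerations-↭ eO (filter-enumerates root≟1 (allTrees-enumerates n))) ⟩
      sum (map (wO x y t) (filter root≟1 (allTrees n)))
        ≡⟨ sum-filter root≟1 (wO x y t) (allTrees n) ⟩
      sum (map (weightO x y (t ^_)) (allTrees n)) ∎
    where
      open ≡-Reasoning
      root≟1 : Decidable (λ T → rootLabel T ≡ 1)
      root≟1 T = rootLabel T ≟ 1

  Orhs-allTrees : ∀ {LI} → 1 ≤ n → Enumerates (IncreasingPlane n) LI →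
                  Orhs n x y t LI ≡ sum (map (weightI x y n (t ^_)) (allTrees n))
  Orhs-allTrees {LI} 1≤n eI = begin
      Orhs n x y t LI
        ≡⟨ Orhs-as-sum n x y t LI degrees ⟩
      sum (map w LI)
        ≡⟨ sum-map-↭ w (enumerations-↭ eI (filter-enumerates increasing? (allTrees-enumerates n))) ⟩
      sum (map w (filter increasing? (allTrees n)))
        ≡⟨ sum-filter increasing? w (allTrees n) ⟩
      sum (map (weightI x y n (t ^_)) (allTrees n)) ∎
    where
      open ≡-Reasoning
      w : PTree → ℕ
      w T = (x + y) ^ (n ∸ rootDeg T) * t ^ rootDeg T
      degrees : All (λ T → rootDeg T ∈ oneTo n) LI
      degrees = All.tabulate λ {T} T∈ → rootDeg∈oneTo T 1≤n (proj₁ (Equivalence.to (proj₂ eI T) T∈))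

theorem1p1 : (n : ℕ) → 1 ≤ n →
    ((LP : List PTree) → Enumerates (LabeledPlane n) LP →
      (x y : ℕ) → Psum x y LP ≡ oddFact n * (x + y) ^ n)
    ×
    ((LO LI : List PTree) →
      Enumerates (λ T → LabeledPlane n T × rootLabel T ≡ 1) LO →
      Enumerates (IncreasingPlane n) LI →
      (x y t : ℕ) → Osum x y t LO ≡ Orhs n x y t LI)
theorem1p1 n 1≤n = P-formula , O-formula
  where
    open ≡-Reasoning

    P-formula : (LP : List PTree) → Enumerates (LabeledPlane n) LP →
                (x y : ℕ) → Psum x y LP ≡ oddFact n * (x + y) ^ n
    P-formula LP eP x y = begin
      Psum x y LP             ≡⟨ sum-map-↭ (wP x y) (enumerations-↭ eP (allTrees-enumerates n)) ⟩
      Psum x y (allTrees n)   ≡⟨ Psum-allTrees x y n ⟩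
      oddFact n * (x + y) ^ n ∎

    O-formula : (LO LI : List PTree) → Enumerates (λ T → LabeledPlane n T × rootLabel T ≡ 1) LO →
                Enumerates (IncreasingPlane n) LI → (x y t : ℕ) → Osum x y t LO ≡ Orhs n x y t LI
    O-formula LO LI eO eI x y t = begin
      Osum x y t LO                                 ≡⟨ Osum-allTrees x y t eO ⟩
      sum (map (weightO x y (t ^_)) (allTrees n))   ≡⟨ weightO≡weightI x y n (t ^_) ⟩
      sum (map (weightI x y n (t ^_)) (allTrees n)) ≡⟨ Orhs-allTrees x y t 1≤n eI ⟨
      Orhs n x y t LI                               ∎
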